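{- Let $p\ge1$ be an integer and let $t,u$ be indeterminates. For $1\le i,j\le p$, let $p_{i,j}$ be formal variables and define the linear form $$A_{i,j}=r_{i,j}\,p_{i,j}-s_{j,i}\,p_{j,i}-[i<p]\,p_{i+1,j}-[j<p]\,p_{i,j+1}-u[i>1]\,p_{i-1,j}-u[j>1]\,p_{i,j-1},$$ where $[\cdot]$ is $1$ if the condition holds and $0$ otherwise, $s_{i,j}=2+t$ if $i<j$, $s_{i,j}=1+2t$ if $i>j$, $s_{i,i}=0$, and $$r_{i,j}=s_{i,j}+u\big([i<p]+[j<p]\big)+[i>1]+[j>1].$$ Let $B$ be the $p^2\times p^2$ matrix with entries $B_{p(i_1-1)+j_1,\;p(i_2-1)+j_2}$ equal to the coefficient of $p_{i_1,j_1}$ in $A_{i_2,j_2}$. Then the rank of $B$ (over the field $\mathbb{Q}(t,u)$) is $p^2-1$.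
   Context: The forms $A_{i,j}$ are the stationarity (balance) equations $A_{i,j}=0$ for the probabilities $p_{i,j}$ of the states $(0,i,j)$ of the doubly asymmetric simple exclusion process $\mathrm{DASEP}(3,p,2)$ (three sites on a circle, two particles with species in $\{1,\dots,p\}$, swap parameter $t$, species-increase parameter $u$), after using rotational symmetry. Explicitly, e.g. for $1<i<j<p$ the equation $A_{i,j}=0$ reads $(4+t+2u)p_{i,j}=(1+2t)p_{j,i}+p_{i+1,j}+p_{i,j+1}+up_{i-1,j}+up_{i,j-1}$, and for $1<j<i<p$ it reads $(3+2t+2u)p_{i,j}=(2+t)p_{j,i}+p_{i+1,j}+p_{i,j+1}+up_{i-1,j}+up_{i,j-1}$. -}

module Defs where

open import Data.Nat as ℕ using (ℕ; zero; suc)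
open import Data.Integer as ℤ using (ℤ; +_)
open import Data.Bool using (Bool; true; false; if_then_else_; _∧_)
open import Data.List using (List; []; _∷_; _++_; map; concatMap)
open import Data.Fin as Fin using (Fin; toℕ; punchIn; remQuot)
open import Data.Product using (_×_; _,_; proj₁; proj₂; Σ)
open import Relation.Binary.PropositionalEquality using (_≡_)
open import Relation.Nullary using (¬_)
open import Function.Definitions using (Injective)

-- The polynomial ring ℤ[t,u]: an element is a finite formal sum of
-- monomials c·t^a·u^b, given as a list of triples (c , a , b).
-- Two such sums are equal iff they have the same coefficients.

Poly : Set
Poly = List (ℤ × ℕ × ℕ)

coeff : Poly → ℕ → ℕ → ℤ
coeff [] a b = + 0
coeff ((c , i , j) ∷ P) a b =
  (if (i ℕ.≡ᵇ a) ∧ (j ℕ.≡ᵇ b) then c else + 0) ℤ.+ coeff P a b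

IsZero : Poly → Set
IsZero P = ∀ a b → coeff P a b ≡ + 0

constP : ℤ → Poly
constP c = (c , 0 , 0) ∷ []

0P 1P tP uP : Poly
0P = []
1P = constP (+ 1)
tP = (+ 1 , 1 , 0) ∷ []
uP = (+ 1 , 0 , 1) ∷ []

infixl 6 _+P_ _-P_
infixl 7 _*P_

_+P_ : Poly → Poly → Poly
_+P_ = _++_

-P_ : Poly → Poly
-P P = map (λ { (c , i , j) → (ℤ.- c , i , j) }) P

_-P_ : Poly → Poly → Poly
P -P Q = P +P (-P Q)

_*P_ : Poly → Poly → Poly
P *P Q = concatMap (λ { (c , i , j) → map (λ { (d , k , l) → (c ℤ.* d , i ℕ.+ k , j ℕ.+ l) }) Q }) P

[_] : Bool → Poly
[ b ] = if b then 1P else 0P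

sumFin : ∀ n → (Fin n → Poly) → Poly
sumFin zero f = 0P
sumFin (suc n) f = f Fin.zero +P sumFin n (λ k → f (Fin.suc k))

altSign : ℕ → Poly → Poly
altSign zero P = P
altSign (suc n) P = -P (altSign n P)

det : ∀ n → (Fin n → Fin n → Poly) → Poly
det zero M = 1P
det (suc n) M =
  sumFin (suc n) (λ j → altSign (toℕ j)
    (M Fin.zero j *P det n (λ r c → M (Fin.suc r) (punchIn j c))))

minor : ∀ {m n r} → (Fin m → Fin n → Poly) → (Fin r → Fin m) → (Fin r → Fin n) → Fin r → Fin r → Poly
minor M f g x y = M (f x) (g y)

-- (determinantal) rank r: some r×r minor is nonzero and all
-- (r+1)×(r+1) minors vanish.  Over the domain ℤ[t,u] this is the rank
-- over the fraction field ℚ(t,u).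
HasRank : ∀ {m n} → (Fin m → Fin n → Poly) → ℕ → Set
HasRank {m} {n} M r =
  Σ (Fin r → Fin m) (λ f → Σ (Fin r → Fin n) (λ g →
      Injective _≡_ _≡_ f × Injective _≡_ _≡_ g × ¬ IsZero (det r (minor M f g))))
  × (∀ (f : Fin (suc r) → Fin m) (g : Fin (suc r) → Fin n) →
      Injective _≡_ _≡_ f → Injective _≡_ _≡_ g → IsZero (det (suc r) (minor M f g)))

-- The DASEP(3,p,2) forms.  Indices are 0-based: the paper's index
-- i ∈ {1..p} is (toℕ i + 1) for i : Fin p.

module _ (p : ℕ) where

  sC : Fin p → Fin p → Poly
  sC i j = if toℕ i ℕ.<ᵇ toℕ j then constP (+ 2) +P tP
           else if toℕ j ℕ.<ᵇ toℕ i then 1P +P constP (+ 2) *P tP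
           else 0P

  -- [i < p] and [i > 1] in the paper's 1-based indexing
  ltP : Fin p → Bool
  ltP i = suc (toℕ i) ℕ.<ᵇ p
  gt1 : Fin p → Bool
  gt1 i = 0 ℕ.<ᵇ toℕ i

  rC : Fin p → Fin p → Poly
  rC i j = sC i j +P uP *P ([ ltP i ] +P [ ltP j ]) +P [ gt1 i ] +P [ gt1 j ]

  -- coefficient of p_{a,b} in A_{i,j}
  coefA : Fin p → Fin p → Fin p → Fin p → Poly
  coefA a b i j =
      [ (toℕ a ℕ.≡ᵇ toℕ i) ∧ (toℕ b ℕ.≡ᵇ toℕ j) ] *P rC i j
    -P [ (toℕ a ℕ.≡ᵇ toℕ j) ∧ (toℕ b ℕ.≡ᵇ toℕ i) ] *P sC j i
    -P [ ltP i ] *P [ (toℕ a ℕ.≡ᵇ suc (toℕ i)) ∧ (toℕ b ℕ.≡ᵇ toℕ j) ]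
    -P [ ltP j ] *P [ (toℕ a ℕ.≡ᵇ toℕ i) ∧ (toℕ b ℕ.≡ᵇ suc (toℕ j)) ]
    -P uP *P [ gt1 i ] *P [ (suc (toℕ a) ℕ.≡ᵇ toℕ i) ∧ (toℕ b ℕ.≡ᵇ toℕ j) ]
    -P uP *P [ gt1 j ] *P [ (toℕ a ℕ.≡ᵇ toℕ i) ∧ (suc (toℕ b) ℕ.≡ᵇ toℕ j) ]

  -- B_{p(i1-1)+j1, p(i2-1)+j2} = coefficient of p_{i1,j1} in A_{i2,j2};
  -- remQuot {p} p k = (i , j) with k = p·i + j (0-based).
  B : Fin (p ℕ.* p) → Fin (p ℕ.* p) → Poly
  B k₁ k₂ = coefA (proj₁ (remQuot {p} p k₁)) (proj₂ (remQuot {p} p k₁))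
                  (proj₁ (remQuot {p} p k₂)) (proj₂ (remQuot {p} p k₂))

-- Each row of B sums to zero: r_{a,b} is by definition the sum of s_{a,b}, [a > 1], [b > 1],
-- u[a < p] and u[b < p], the coefficients (up to sign) with which p_{a,b} enters the other equations.
-- Hence every p² × p² minor has zero row sums, its columns being a permutation of all columns, and
-- vanishes: in the expansion along the first row the minors obtained by deleting two adjacent columns
-- cancel, because merging those two columns gives a smaller matrix with zero row sums.
-- For a nonzero minor of size p² - 1, delete the row and column of the state (1,1) and put t = -2,
-- u = 0. Then s_{i,j} = 2 + t vanishes for i < j and all u-terms disappear, so in the lexicographic
-- order of the states the matrix is lower triangular with diagonal entries r_{i,j} ∈ {±1, ±2}; its
-- determinant is a nonzero integer, so the minor is a nonzero polynomial.

module Submission where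

open import Defs
open import Algebra.Bundles using (CommutativeMonoid; CommutativeRing)
open import Data.Bool using (true; false; if_then_else_; _∧_)
open import Data.Fin as Fin using (Fin; toℕ)
import Data.Integer.Properties as ℤ
open import Algebra.Morphism.Structures using (module RingMorphisms)
open RingMorphisms using (IsRingHomomorphism)
open import Data.Nat as ℕ using (ℕ; zero; suc; _≡ᵇ_; _<ᵇ_)
open import Data.Product using (_×_; _,_; proj₁; proj₂)
open import Data.Product.Relation.Binary.Lex.Strict using (×-Lex)
open import Relation.Binary.PropositionalEquality using (_≡_; _≢_)

module _ where
  open import Data.Bool.Properties using (T-≡; T-∧; ¬-not)
  open import Data.Nat.Properties using (≡ᵇ⇒≡; ≡⇒≡ᵇ; <ᵇ⇒<; <⇒<ᵇ)
  open import Function.Bundles using (Equivalence)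
  open import Relation.Nullary using (¬_)
  open import Relation.Binary.PropositionalEquality using (refl)
  open Equivalence

  ≡ᵇ-∧-true : ∀ {i j a b} → ((i ≡ᵇ a) ∧ (j ≡ᵇ b)) ≡ true → i ≡ a × j ≡ b
  ≡ᵇ-∧-true {i} {j} {a} {b} eq with to T-∧ (from T-≡ eq)
  ... | i≡ᵇa , j≡ᵇb = ≡ᵇ⇒≡ i a i≡ᵇa , ≡ᵇ⇒≡ j b j≡ᵇb

  ≡ᵇ-∧-false : ∀ {i j a b} → ¬ (i ≡ a × j ≡ b) → ((i ≡ᵇ a) ∧ (j ≡ᵇ b)) ≡ false
  ≡ᵇ-∧-false ne = ¬-not (λ eq → ne (≡ᵇ-∧-true eq))

  ≡ᵇ-∧-refl : ∀ i j → ((i ≡ᵇ i) ∧ (j ≡ᵇ j)) ≡ true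
  ≡ᵇ-∧-refl i j = to T-≡ (from T-∧ (≡⇒≡ᵇ i i refl , ≡⇒≡ᵇ j j refl))

  <ᵇ-true : ∀ {m n} → m ℕ.< n → (m <ᵇ n) ≡ true
  <ᵇ-true m<n = to T-≡ (<⇒<ᵇ m<n)

  <ᵇ-false : ∀ {m n} → ¬ m ℕ.< n → (m <ᵇ n) ≡ false
  <ᵇ-false {m} {n} m≮n = ¬-not (λ eq → m≮n (<ᵇ⇒< m n (from T-≡ eq)))

-- Finite sums

module FiniteSum {a ℓ} (M : CommutativeMonoid a ℓ) where
  open CommutativeMonoid M renaming (_∙_ to _+_; ε to 0#)
  open import Algebra.Properties.CommutativeMonoid.Sum M public
  open import Algebra.Properties.CommutativeSemigroup commutativeSemigroup using (x∙yz≈y∙xz; xy∙z≈y∙xz)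
  open import Data.Fin using (zero; suc; punchIn; punchOut; splitAt; quotRem; remQuot)
  open import Data.Fin.Properties using (punchIn-punchOut; punchOut-injective; suc-injective)
  open import Data.Product using (uncurry; swap; map₂)
  open import Data.Sum as Sum using (_⊎_; inj₁; inj₂; [_,_]′)
  open import Data.Vec.Functional using (updateAt)
  open import Function using (_∘_)
  open import Function.Definitions using (Injective)
  import Relation.Binary.PropositionalEquality as ≡
  open import Relation.Binary.Reasoning.Setoid setoid

  sum-cong : ∀ {n} {f g : Fin n → Carrier} → (∀ k → f k ≈ g k) → sum f ≈ sum g
  sum-cong {n} {f} {g} = sum-cong-≋ {n} {f} {g}

  sum-zero : ∀ n → sum {n} (λ _ → 0#) ≈ 0#
  sum-zero = sum-replicate-zero

  sum-indicator : ∀ N c (f : ℕ → Carrier) →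
    sum {N} (λ k → if c ≡ᵇ toℕ k then f (toℕ k) else 0#) ≈ (if c <ᵇ N then f c else 0#)
  sum-indicator zero    c       f = refl
  sum-indicator (suc N) zero    f = trans (∙-congˡ (sum-zero N)) (identityʳ (f 0))
  sum-indicator (suc N) (suc c) f = trans (identityˡ _) (sum-indicator N c (λ k → f (suc k)))

  sum-updateAt : ∀ {n} (v : Fin n → Carrier) k a → sum (updateAt v k (_+ a)) ≈ a + sum v
  sum-updateAt {suc n} v zero    a = xy∙z≈y∙xz (v zero) a (sum (λ j → v (suc j)))
  sum-updateAt {suc n} v (suc k) a =
    trans (∙-congˡ (sum-updateAt (λ j → v (suc j)) k a)) (x∙yz≈y∙xz (v zero) a _)

  sum-reindex : ∀ {n} (g : Fin n → Fin n) → Injective _≡_ _≡_ g → ∀ (f : Fin n → Carrier) → sum (f ∘ g) ≈ sum f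
  sum-reindex {zero}  g g-inj f = refl
  sum-reindex {suc n} g g-inj f = begin
      f (g zero) + sum (f ∘ g ∘ suc)
    ≈⟨ ∙-congˡ (sum-cong {n} (λ c → reflexive (≡.cong f (≡.sym (punchIn-punchOut (g₀≢ c)))))) ⟩
      f (g zero) + sum (f ∘ punchIn (g zero) ∘ g′)
    ≈⟨ ∙-congˡ (sum-reindex g′ g′-injective (f ∘ punchIn (g zero))) ⟩
      f (g zero) + sum (f ∘ punchIn (g zero))
    ≈⟨ sum-remove f ⟨
      sum f ∎
    where
      g₀≢ : ∀ c → g zero ≢ g (suc c)
      g₀≢ c eq with g-inj eq
      ... | ()
      g′ : Fin n → Fin n
      g′ c = punchOut (g₀≢ c)
      g′-injective : Injective _≡_ _≡_ g′
      g′-injective eq = suc-injective (g-inj (punchOut-injective (g₀≢ _) (g₀≢ _) eq))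

  sum-splitAt : ∀ m n (f : Fin m ⊎ Fin n → Carrier) → sum {m ℕ.+ n} (f ∘ splitAt m) ≈ sum (f ∘ inj₁) + sum (f ∘ inj₂)
  sum-splitAt zero    n f = sym (identityˡ _)
  sum-splitAt (suc m) n f = trans (∙-congˡ (sum-splitAt m n (f ∘ Sum.map₁ suc))) (sym (assoc _ _ _))

  sum-remQuot : ∀ m n (f : Fin m → Fin n → Carrier) →
    sum {m ℕ.* n} (λ k → uncurry f (remQuot n k)) ≈ sum (λ i → sum (λ j → f i j))
  sum-remQuot zero    n f = refl
  -- On Fin (suc m * n), remQuot n is by definition a case split on splitAt n.
  sum-remQuot (suc m) n f =
    trans (sum-splitAt n (m ℕ.* n) (λ k → uncurry f (swap ([ (_, zero) , map₂ suc ∘ quotRem {m} n ]′ k))))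
          (∙-congˡ (sum-remQuot m n (λ i → f (suc i))))

module _ {c ℓ} (R : CommutativeRing c ℓ) where
  open CommutativeRing R hiding (zero)
  open FiniteSum +-commutativeMonoid using (sum)
  open import Algebra.Properties.Ring ring using (-‿+-comm; -0#≈0#)

  sum-neg : ∀ {n} (f : Fin n → Carrier) → sum (λ k → - f k) ≈ - sum f
  sum-neg {zero}  f = sym -0#≈0#
  sum-neg {suc n} f = trans (+-congˡ (sum-neg (λ k → f (Fin.suc k)))) (-‿+-comm (f Fin.zero) _)

-- The polynomial ring ℤ[t,u]

module PolynomialRing where
  open import Data.List using (List; []; _∷_; map)
  open import Data.Nat using (_⊔_; _≤_; _<_)
  import Data.Nat.Properties as ℕ
  open import Data.Integer using (ℤ; 0ℤ; 1ℤ; _+_; _*_; -_; _^_)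
  open import Algebra.Properties.CommutativeSemigroup ℤ.+-commutativeSemigroup using (interchange)
  open import Algebra.Properties.CommutativeSemigroup ℤ.*-commutativeSemigroup
    using (x∙yz≈y∙xz) renaming (interchange to ×-interchange)
  import Data.List.Properties as List
  open import Data.List.Membership.Propositional using (_∈_)
  open import Data.List.Relation.Unary.All as All using (All; all?)
  open import Data.List.Relation.Unary.Any using (here; there)
  open import Relation.Binary.Structures using (IsEquivalence)
  open import Relation.Nullary using (Dec; map′; contradiction)
  open import Relation.Nullary.Decidable using (decidable-stable)
  open import Data.Product using (uncurry)
  open import Level using (0ℓ)
  open import Relation.Binary.PropositionalEquality hiding ([_])
  open ≡-Reasoning

  Weight : Set
  Weight = ℕ → ℕ → ℤ

  -- Coefficients are the case w = δ a b, and
  -- ⟪⟫-cong shows that ⟪ P ∣ w ⟫ only depends on the coefficients of P, so the ring laws of _≈P_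
  -- follow from integer identities between pairings.
  ⟪_∣_⟫ : Poly → Weight → ℤ
  ⟪ [] ∣ w ⟫ = 0ℤ
  ⟪ (c , i , j) ∷ P ∣ w ⟫ = c * w i j + ⟪ P ∣ w ⟫

  shift : Weight → ℕ → ℕ → Weight
  shift w i j k l = w (i ℕ.+ k) (j ℕ.+ l)

  ⟪⟫-congʳ : ∀ P {v w : Weight} → (∀ i j → v i j ≡ w i j) → ⟪ P ∣ v ⟫ ≡ ⟪ P ∣ w ⟫
  ⟪⟫-congʳ [] e = refl
  ⟪⟫-congʳ ((c , i , j) ∷ P) e = cong₂ _+_ (cong (c *_) (e i j)) (⟪⟫-congʳ P e)

  ⟪⟫-zeroʳ : ∀ P → ⟪ P ∣ (λ _ _ → 0ℤ) ⟫ ≡ 0ℤ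
  ⟪⟫-zeroʳ [] = refl
  ⟪⟫-zeroʳ ((c , i , j) ∷ P) = cong₂ _+_ (ℤ.*-zeroʳ c) (⟪⟫-zeroʳ P)

  ⟪⟫-distribʳ-+ : ∀ P (v w : Weight) → ⟪ P ∣ (λ i j → v i j + w i j) ⟫ ≡ ⟪ P ∣ v ⟫ + ⟪ P ∣ w ⟫
  ⟪⟫-distribʳ-+ [] v w = refl
  ⟪⟫-distribʳ-+ ((c , i , j) ∷ P) v w =
    trans (cong₂ _+_ (ℤ.*-distribˡ-+ c (v i j) (w i j)) (⟪⟫-distribʳ-+ P v w))
          (interchange (c * v i j) (c * w i j) ⟪ P ∣ v ⟫ ⟪ P ∣ w ⟫)

  ⟪⟫-*ʳ : ∀ P a (w : Weight) → ⟪ P ∣ (λ i j → a * w i j) ⟫ ≡ a * ⟪ P ∣ w ⟫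
  ⟪⟫-*ʳ [] a w = sym (ℤ.*-zeroʳ a)
  ⟪⟫-*ʳ ((c , i , j) ∷ P) a w =
    trans (cong₂ _+_ (x∙yz≈y∙xz c a (w i j)) (⟪⟫-*ʳ P a w))
          (sym (ℤ.*-distribˡ-+ a (c * w i j) ⟪ P ∣ w ⟫))

  ⟪⟫-swap : ∀ P Q (h : ℕ → ℕ → Weight) →
    ⟪ P ∣ (λ i j → ⟪ Q ∣ h i j ⟫) ⟫ ≡ ⟪ Q ∣ (λ k l → ⟪ P ∣ (λ i j → h i j k l) ⟫) ⟫
  ⟪⟫-swap [] Q h = sym (⟪⟫-zeroʳ Q)
  ⟪⟫-swap ((c , i , j) ∷ P) Q h =
    trans (cong₂ _+_ (sym (⟪⟫-*ʳ Q c (h i j))) (⟪⟫-swap P Q h))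
          (sym (⟪⟫-distribʳ-+ Q _ _))

  ⟪⟫-++ : ∀ P Q w → ⟪ P +P Q ∣ w ⟫ ≡ ⟪ P ∣ w ⟫ + ⟪ Q ∣ w ⟫
  ⟪⟫-++ [] Q w = sym (ℤ.+-identityˡ _)
  ⟪⟫-++ ((c , i , j) ∷ P) Q w =
    trans (cong (c * w i j +_) (⟪⟫-++ P Q w)) (sym (ℤ.+-assoc (c * w i j) _ _))

  ⟪⟫-neg : ∀ P w → ⟪ -P P ∣ w ⟫ ≡ - ⟪ P ∣ w ⟫
  ⟪⟫-neg [] w = refl
  ⟪⟫-neg ((c , i , j) ∷ P) w =
    trans (cong₂ _+_ (sym (ℤ.neg-distribˡ-* c (w i j))) (⟪⟫-neg P w))
          (sym (ℤ.neg-distrib-+ (c * w i j) ⟪ P ∣ w ⟫))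

  -- f stands for the pattern-matching λ inside _*P_, which can only be described by its values.
  ⟪⟫-map : ∀ {c i j} {f : ℤ × ℕ × ℕ → ℤ × ℕ × ℕ} Q w →
    (∀ d k l → f (d , k , l) ≡ (c * d , i ℕ.+ k , j ℕ.+ l)) →
    ⟪ map f Q ∣ w ⟫ ≡ c * ⟪ Q ∣ shift w i j ⟫
  ⟪⟫-map {c} [] w f-spec = sym (ℤ.*-zeroʳ c)
  ⟪⟫-map {c} {i} {j} {f} ((d , k , l) ∷ Q) w f-spec rewrite f-spec d k l =
    trans (cong₂ _+_ (ℤ.*-assoc c d _) (⟪⟫-map {c} {i} {j} Q w f-spec))
          (sym (ℤ.*-distribˡ-+ c (d * w (i ℕ.+ k) (j ℕ.+ l)) _))

  ⟪⟫-* : ∀ P Q w → ⟪ P *P Q ∣ w ⟫ ≡ ⟪ P ∣ (λ i j → ⟪ Q ∣ shift w i j ⟫) ⟫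
  ⟪⟫-* [] Q w = refl
  ⟪⟫-* ((c , i , j) ∷ P) Q w =
    trans (⟪⟫-++ (map _ Q) (P *P Q) w)
          (cong₂ _+_ (⟪⟫-map {c} {i} {j} Q w (λ _ _ _ → refl)) (⟪⟫-* P Q w))

  δ : ℕ → ℕ → Weight
  δ a b i j = if (i ≡ᵇ a) ∧ (j ≡ᵇ b) then 1ℤ else 0ℤ

  coeff-⟪⟫ : ∀ P a b → coeff P a b ≡ ⟪ P ∣ δ a b ⟫
  coeff-⟪⟫ [] a b = refl
  coeff-⟪⟫ ((c , i , j) ∷ P) a b = cong₂ _+_ (select ((i ≡ᵇ a) ∧ (j ≡ᵇ b))) (coeff-⟪⟫ P a b)
    where
      select : ∀ x → (if x then c else 0ℤ) ≡ c * (if x then 1ℤ else 0ℤ)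
      select true  = sym (ℤ.*-identityʳ c)
      select false = sym (ℤ.*-zeroʳ c)

  open FiniteSum ℤ.+-0-commutativeMonoid using (sum; sum-cong; sum-zero; ∑-distrib-+; sum-indicator)

  box : ℕ → Weight → ℤ
  box N w = sum {N} (λ a → sum {N} (λ b → w (toℕ a) (toℕ b)))

  box-cong : ∀ N {v w : Weight} → (∀ a b → v a b ≡ w a b) → box N v ≡ box N w
  box-cong N e = sum-cong {N} (λ a → sum-cong {N} (λ b → e (toℕ a) (toℕ b)))

  box-+ : ∀ N (v w : Weight) → box N (λ a b → v a b + w a b) ≡ box N v + box N w
  box-+ N v w = trans (sum-cong {N} (λ a → ∑-distrib-+ {N} (λ b → v (toℕ a) (toℕ b)) (λ b → w (toℕ a) (toℕ b))))
                     (∑-distrib-+ {N} (λ a → sum {N} (λ b → v (toℕ a) (toℕ b))) (λ a → sum {N} (λ b → w (toℕ a) (toℕ b))))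

  box-zero : ∀ N → box N (λ _ _ → 0ℤ) ≡ 0ℤ
  box-zero N = trans (sum-cong {N} (λ _ → sum-zero N)) (sum-zero N)

  box-monomial : ∀ {N} c i j (w : Weight) → i < N → j < N →
    box N (λ a b → (if (i ≡ᵇ a) ∧ (j ≡ᵇ b) then c else 0ℤ) * w a b) ≡ c * w i j
  box-monomial {N} c i j w i<N j<N = begin
      box N (λ a b → (if (i ≡ᵇ a) ∧ (j ≡ᵇ b) then c else 0ℤ) * w a b)
    ≡⟨ sum-cong {N} (λ a → select (i ≡ᵇ toℕ a) (toℕ a)) ⟩
      sum {N} (λ a → if i ≡ᵇ toℕ a then row (toℕ a) else 0ℤ)
    ≡⟨ sum-indicator N i row ⟩
      (if i <ᵇ N then row i else 0ℤ)
    ≡⟨ cong (if_then row i else 0ℤ) (<ᵇ-true i<N) ⟩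
      row i
    ≡⟨ sum-indicator N j (λ b → c * w i b) ⟩
      (if j <ᵇ N then c * w i j else 0ℤ)
    ≡⟨ cong (if_then c * w i j else 0ℤ) (<ᵇ-true j<N) ⟩
      c * w i j ∎
    where
      row : ℕ → ℤ
      row a = sum {N} (λ b → if j ≡ᵇ toℕ b then c * w a (toℕ b) else 0ℤ)
      scale : ∀ y z → (if y then c else 0ℤ) * z ≡ (if y then c * z else 0ℤ)
      scale true  z = refl
      scale false z = refl
      select : ∀ x a → sum {N} (λ b → (if x ∧ (j ≡ᵇ toℕ b) then c else 0ℤ) * w a (toℕ b)) ≡ (if x then row a else 0ℤ)
      select true  a = sum-cong {N} (λ b → scale (j ≡ᵇ toℕ b) (w a (toℕ b)))
      select false a = sum-zero N

  bound : Poly → ℕ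
  bound [] = 0
  bound ((c , i , j) ∷ P) = suc (i ⊔ j) ⊔ bound P

  ⟪⟫-box : ∀ P w {N} → bound P ≤ N → ⟪ P ∣ w ⟫ ≡ box N (λ a b → coeff P a b * w a b)
  ⟪⟫-box [] w {N} _ = sym (box-zero N)
  ⟪⟫-box ((c , i , j) ∷ P) w {N} le = begin
      c * w i j + ⟪ P ∣ w ⟫
    ≡⟨ cong₂ _+_ (sym (box-monomial c i j w i<N j<N)) (⟪⟫-box P w (ℕ.m⊔n≤o⇒n≤o _ (bound P) le)) ⟩
      box N head + box N tail
    ≡⟨ sym (box-+ N head tail) ⟩
      box N (λ a b → head a b + tail a b)
    ≡⟨ box-cong N (λ a b → sym (ℤ.*-distribʳ-+ (w a b) (if (i ≡ᵇ a) ∧ (j ≡ᵇ b) then c else 0ℤ) (coeff P a b))) ⟩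
      box N (λ a b → coeff ((c , i , j) ∷ P) a b * w a b) ∎
    where
      head tail : Weight
      head a b = (if (i ≡ᵇ a) ∧ (j ≡ᵇ b) then c else 0ℤ) * w a b
      tail a b = coeff P a b * w a b
      ij<N : suc (i ⊔ j) ≤ N
      ij<N = ℕ.m⊔n≤o⇒m≤o _ (bound P) le
      i<N : i < N
      i<N = ℕ.<-≤-trans (ℕ.s≤s (ℕ.m≤m⊔n i j)) ij<N
      j<N : j < N
      j<N = ℕ.<-≤-trans (ℕ.s≤s (ℕ.m≤n⊔m i j)) ij<N

  infix 4 _≈P_
  record _≈P_ (P Q : Poly) : Set where
    constructor mk≈
    field coeff-≡ : ∀ a b → coeff P a b ≡ coeff Q a b
  open _≈P_ public

  ⟪⟫-cong : ∀ {P Q} → P ≈P Q → ∀ w → ⟪ P ∣ w ⟫ ≡ ⟪ Q ∣ w ⟫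
  ⟪⟫-cong {P} {Q} (mk≈ e) w = begin
      ⟪ P ∣ w ⟫
    ≡⟨ ⟪⟫-box P w (ℕ.m≤m⊔n (bound P) (bound Q)) ⟩
      box N (λ a b → coeff P a b * w a b)
    ≡⟨ box-cong N (λ a b → cong (_* w a b) (e a b)) ⟩
      box N (λ a b → coeff Q a b * w a b)
    ≡⟨ sym (⟪⟫-box Q w (ℕ.m≤n⊔m (bound P) (bound Q))) ⟩
      ⟪ Q ∣ w ⟫ ∎
    where N = bound P ⊔ bound Q

  ≈-by-⟪⟫ : ∀ {P Q} → (∀ w → ⟪ P ∣ w ⟫ ≡ ⟪ Q ∣ w ⟫) → P ≈P Q
  ≈-by-⟪⟫ {P} {Q} e = mk≈ (λ a b → trans (coeff-⟪⟫ P a b) (trans (e (δ a b)) (sym (coeff-⟪⟫ Q a b))))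

  ≈-trans : ∀ {P Q R} → P ≈P Q → Q ≈P R → P ≈P R
  ≈-trans e f = mk≈ (λ a b → trans (coeff-≡ e a b) (coeff-≡ f a b))

  ≡⇒≈ : ∀ {P Q} → P ≡ Q → P ≈P Q
  ≡⇒≈ refl = mk≈ (λ _ _ → refl)

  +-cong : ∀ {P P' Q Q'} → P ≈P P' → Q ≈P Q' → P +P Q ≈P P' +P Q'
  +-cong {P} {P'} {Q} {Q'} e f = ≈-by-⟪⟫ λ w → begin
    ⟪ P +P Q ∣ w ⟫          ≡⟨ ⟪⟫-++ P Q w ⟩
    ⟪ P ∣ w ⟫ + ⟪ Q ∣ w ⟫    ≡⟨ cong₂ _+_ (⟪⟫-cong e w) (⟪⟫-cong f w) ⟩
    ⟪ P' ∣ w ⟫ + ⟪ Q' ∣ w ⟫  ≡⟨ ⟪⟫-++ P' Q' w ⟨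
    ⟪ P' +P Q' ∣ w ⟫        ∎

  +-comm : ∀ P Q → P +P Q ≈P Q +P P
  +-comm P Q = ≈-by-⟪⟫ λ w → trans (⟪⟫-++ P Q w) (trans (ℤ.+-comm ⟪ P ∣ w ⟫ ⟪ Q ∣ w ⟫) (sym (⟪⟫-++ Q P w)))

  neg-cong : ∀ {P Q} → P ≈P Q → -P P ≈P -P Q
  neg-cong {P} {Q} e = ≈-by-⟪⟫ λ w → trans (⟪⟫-neg P w) (trans (cong -_ (⟪⟫-cong e w)) (sym (⟪⟫-neg Q w)))

  neg-inverseˡ : ∀ P → -P P +P P ≈P 0P
  neg-inverseˡ P = ≈-by-⟪⟫ λ w →
    trans (⟪⟫-++ (-P P) P w) (trans (cong (_+ ⟪ P ∣ w ⟫) (⟪⟫-neg P w)) (ℤ.+-inverseˡ ⟪ P ∣ w ⟫))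

  neg-inverseʳ : ∀ P → P +P -P P ≈P 0P
  neg-inverseʳ P = ≈-by-⟪⟫ λ w →
    trans (⟪⟫-++ P (-P P) w) (trans (cong (⟪ P ∣ w ⟫ +_) (⟪⟫-neg P w)) (ℤ.+-inverseʳ ⟪ P ∣ w ⟫))

  *-cong : ∀ {P P' Q Q'} → P ≈P P' → Q ≈P Q' → P *P Q ≈P P' *P Q'
  *-cong {P} {P'} {Q} {Q'} e f = ≈-by-⟪⟫ λ w → begin
    ⟪ P *P Q ∣ w ⟫                                ≡⟨ ⟪⟫-* P Q w ⟩
    ⟪ P ∣ (λ i j → ⟪ Q ∣ shift w i j ⟫) ⟫          ≡⟨ ⟪⟫-cong e (λ i j → ⟪ Q ∣ shift w i j ⟫) ⟩
    ⟪ P' ∣ (λ i j → ⟪ Q ∣ shift w i j ⟫) ⟫         ≡⟨ ⟪⟫-congʳ P' (λ i j → ⟪⟫-cong f (shift w i j)) ⟩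
    ⟪ P' ∣ (λ i j → ⟪ Q' ∣ shift w i j ⟫) ⟫        ≡⟨ ⟪⟫-* P' Q' w ⟨
    ⟪ P' *P Q' ∣ w ⟫                              ∎

  *-assoc : ∀ P Q R → (P *P Q) *P R ≈P P *P (Q *P R)
  *-assoc P Q R = ≈-by-⟪⟫ λ w → begin
    ⟪ (P *P Q) *P R ∣ w ⟫
      ≡⟨ trans (⟪⟫-* (P *P Q) R w) (⟪⟫-* P Q _) ⟩
    ⟪ P ∣ (λ i j → ⟪ Q ∣ (λ k l → ⟪ R ∣ shift w (i ℕ.+ k) (j ℕ.+ l) ⟫) ⟫) ⟫
      ≡⟨ ⟪⟫-congʳ P (λ i j → ⟪⟫-congʳ Q (λ k l → ⟪⟫-congʳ R (λ m n →
           cong₂ w (ℕ.+-assoc i k m) (ℕ.+-assoc j l n)))) ⟩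
    ⟪ P ∣ (λ i j → ⟪ Q ∣ (λ k l → ⟪ R ∣ shift (shift w i j) k l ⟫) ⟫) ⟫
      ≡⟨ ⟪⟫-congʳ P (λ i j → ⟪⟫-* Q R (shift w i j)) ⟨
    ⟪ P ∣ (λ i j → ⟪ Q *P R ∣ shift w i j ⟫) ⟫
      ≡⟨ ⟪⟫-* P (Q *P R) w ⟨
    ⟪ P *P (Q *P R) ∣ w ⟫ ∎

  *-comm : ∀ P Q → P *P Q ≈P Q *P P
  *-comm P Q = ≈-by-⟪⟫ λ w → begin
    ⟪ P *P Q ∣ w ⟫                                                 ≡⟨ ⟪⟫-* P Q w ⟩
    ⟪ P ∣ (λ i j → ⟪ Q ∣ shift w i j ⟫) ⟫                           ≡⟨ ⟪⟫-swap P Q (shift w) ⟩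
    ⟪ Q ∣ (λ k l → ⟪ P ∣ (λ i j → w (i ℕ.+ k) (j ℕ.+ l)) ⟫) ⟫        ≡⟨ ⟪⟫-congʳ Q (λ k l → ⟪⟫-congʳ P (λ i j →
                                                                         cong₂ w (ℕ.+-comm i k) (ℕ.+-comm j l))) ⟩
    ⟪ Q ∣ (λ k l → ⟪ P ∣ shift w k l ⟫) ⟫                           ≡⟨ ⟪⟫-* Q P w ⟨
    ⟪ Q *P P ∣ w ⟫                                                 ∎

  *-identityˡ : ∀ P → 1P *P P ≈P P
  *-identityˡ P = ≈-by-⟪⟫ λ w →
    trans (⟪⟫-* 1P P w) (trans (ℤ.+-identityʳ _) (ℤ.*-identityˡ ⟪ P ∣ w ⟫))

  *-identityʳ : ∀ P → P *P 1P ≈P P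
  *-identityʳ P = ≈-trans (*-comm P 1P) (*-identityˡ P)

  distribˡ : ∀ P Q R → P *P (Q +P R) ≈P P *P Q +P P *P R
  distribˡ P Q R = ≈-by-⟪⟫ λ w → begin
    ⟪ P *P (Q +P R) ∣ w ⟫
      ≡⟨ ⟪⟫-* P (Q +P R) w ⟩
    ⟪ P ∣ (λ i j → ⟪ Q +P R ∣ shift w i j ⟫) ⟫
      ≡⟨ ⟪⟫-congʳ P (λ i j → ⟪⟫-++ Q R (shift w i j)) ⟩
    ⟪ P ∣ (λ i j → ⟪ Q ∣ shift w i j ⟫ + ⟪ R ∣ shift w i j ⟫) ⟫
      ≡⟨ ⟪⟫-distribʳ-+ P (λ i j → ⟪ Q ∣ shift w i j ⟫) (λ i j → ⟪ R ∣ shift w i j ⟫) ⟩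
    ⟪ P ∣ (λ i j → ⟪ Q ∣ shift w i j ⟫) ⟫ + ⟪ P ∣ (λ i j → ⟪ R ∣ shift w i j ⟫) ⟫
      ≡⟨ cong₂ _+_ (⟪⟫-* P Q w) (⟪⟫-* P R w) ⟨
    ⟪ P *P Q ∣ w ⟫ + ⟪ P *P R ∣ w ⟫
      ≡⟨ ⟪⟫-++ (P *P Q) (P *P R) w ⟨
    ⟪ P *P Q +P P *P R ∣ w ⟫ ∎

  distribʳ : ∀ P Q R → (Q +P R) *P P ≈P Q *P P +P R *P P
  distribʳ P Q R = ≈-by-⟪⟫ λ w → begin
    ⟪ (Q +P R) *P P ∣ w ⟫                        ≡⟨ ⟪⟫-* (Q +P R) P w ⟩
    ⟪ Q +P R ∣ G w ⟫                              ≡⟨ ⟪⟫-++ Q R (G w) ⟩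
    ⟪ Q ∣ G w ⟫ + ⟪ R ∣ G w ⟫                      ≡⟨ cong₂ _+_ (⟪⟫-* Q P w) (⟪⟫-* R P w) ⟨
    ⟪ Q *P P ∣ w ⟫ + ⟪ R *P P ∣ w ⟫                ≡⟨ ⟪⟫-++ (Q *P P) (R *P P) w ⟨
    ⟪ Q *P P +P R *P P ∣ w ⟫                      ∎
    where
      G : Weight → Weight
      G w i j = ⟪ P ∣ shift w i j ⟫

  ≈-isEquivalence : IsEquivalence _≈P_
  ≈-isEquivalence = record
    { refl  = mk≈ (λ _ _ → refl)
    ; sym   = λ e → mk≈ (λ a b → sym (coeff-≡ e a b))
    ; trans = ≈-trans
    }

  +P-*P-commutativeRing : CommutativeRing 0ℓ 0ℓ
  +P-*P-commutativeRing = record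
    { Carrier = Poly ; _≈_ = _≈P_ ; _+_ = _+P_ ; _*_ = _*P_ ; -_ = -P_ ; 0# = 0P ; 1# = 1P
    ; isCommutativeRing = record
      { isRing = record
        { +-isAbelianGroup = record
          { isGroup = record
            { isMonoid = record
              { isSemigroup = record
                { isMagma = record { isEquivalence = ≈-isEquivalence ; ∙-cong = +-cong }
                ; assoc   = λ P Q R → ≡⇒≈ (List.++-assoc P Q R)
                }
              ; identity = (λ P → ≡⇒≈ refl) , (λ P → ≡⇒≈ (List.++-identityʳ P))
              }
            ; inverse = neg-inverseˡ , neg-inverseʳ
            ; ⁻¹-cong = neg-cong
            }
          ; comm = +-comm
          }
        ; *-cong     = *-cong
        ; *-assoc    = *-assoc
        ; *-identity = *-identityˡ , *-identityʳ
        ; distrib    = distribˡ , distribʳ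
        }
      ; *-comm = *-comm
      }
    }

  [_]*-if : ∀ b X → [ b ] *P X ≈P (if b then X else 0P)
  [ true  ]*-if X = *-identityˡ X
  [ false ]*-if X = ≡⇒≈ refl

  [true]* : ∀ {b} X → b ≡ true → [ b ] *P X ≈P X
  [true]* X refl = *-identityˡ X

  exponents : Poly → List (ℕ × ℕ)
  exponents = map proj₂

  coeff-support : ∀ P a b → coeff P a b ≢ 0ℤ → (a , b) ∈ exponents P
  coeff-support [] a b nz = contradiction refl nz
  coeff-support ((c , i , j) ∷ P) a b nz with (i ≡ᵇ a) ∧ (j ≡ᵇ b) in eq
  ... | true  = here (sym (uncurry (cong₂ _,_) (≡ᵇ-∧-true eq)))
  ... | false = there (coeff-support P a b (λ z → nz (trans (ℤ.+-identityˡ _) z)))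

  isZero? : ∀ P → Dec (IsZero P)
  isZero? P = map′ vanishes (λ z → All.tabulate (λ {ab} _ → z (proj₁ ab) (proj₂ ab)))
                   (all? (λ ab → coeff P (proj₁ ab) (proj₂ ab) ℤ.≟ 0ℤ) (exponents P))
    where
      vanishes : All (λ ab → coeff P (proj₁ ab) (proj₂ ab) ≡ 0ℤ) (exponents P) → IsZero P
      vanishes zs a b = decidable-stable (coeff P a b ℤ.≟ 0ℤ)
                          (λ nz → nz (All.lookup zs (coeff-support P a b nz)))

  evalAt : ℤ → ℤ → Poly → ℤ
  evalAt t u P = ⟪ P ∣ (λ i j → t ^ i * u ^ j) ⟫

  module _ (t u : ℤ) where
    private
      monomial : Weight
      monomial i j = t ^ i * u ^ j

      monomial-shift : ∀ i j k l → shift monomial i j k l ≡ monomial i j * monomial k l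
      monomial-shift i j k l = begin
        t ^ (i ℕ.+ k) * u ^ (j ℕ.+ l)        ≡⟨ cong₂ _*_ (ℤ.^-distribˡ-+-* t i k) (ℤ.^-distribˡ-+-* u j l) ⟩
        (t ^ i * t ^ k) * (u ^ j * u ^ l)    ≡⟨ ×-interchange (t ^ i) (t ^ k) (u ^ j) (u ^ l) ⟩
        (t ^ i * u ^ j) * (t ^ k * u ^ l)    ∎

    evalAt-* : ∀ P Q → evalAt t u (P *P Q) ≡ evalAt t u P * evalAt t u Q
    evalAt-* P Q = begin
      ⟪ P *P Q ∣ monomial ⟫                                           ≡⟨ ⟪⟫-* P Q monomial ⟩
      ⟪ P ∣ (λ i j → ⟪ Q ∣ shift monomial i j ⟫) ⟫                      ≡⟨ ⟪⟫-congʳ P (λ i j →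
                                                                          trans (⟪⟫-congʳ Q (monomial-shift i j))
                                                                                (⟪⟫-*ʳ Q (monomial i j) monomial)) ⟩
      ⟪ P ∣ (λ i j → monomial i j * ⟪ Q ∣ monomial ⟫) ⟫                 ≡⟨ ⟪⟫-congʳ P (λ i j → ℤ.*-comm (monomial i j) _) ⟩
      ⟪ P ∣ (λ i j → ⟪ Q ∣ monomial ⟫ * monomial i j) ⟫                 ≡⟨ ⟪⟫-*ʳ P ⟪ Q ∣ monomial ⟫ monomial ⟩
      ⟪ Q ∣ monomial ⟫ * ⟪ P ∣ monomial ⟫                               ≡⟨ ℤ.*-comm ⟪ Q ∣ monomial ⟫ _ ⟩
      ⟪ P ∣ monomial ⟫ * ⟪ Q ∣ monomial ⟫                               ∎

    evalAt-isRingHomomorphism : IsRingHomomorphism (CommutativeRing.rawRing +P-*P-commutativeRing) (CommutativeRing.rawRing ℤ.+-*-commutativeRing) (evalAt t u)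
    evalAt-isRingHomomorphism = record
      { isSemiringHomomorphism = record
        { isNearSemiringHomomorphism = record
          { +-isMonoidHomomorphism = record
            { isMagmaHomomorphism = record
              { isRelHomomorphism = record { cong = λ e → ⟪⟫-cong e monomial }
              ; homo = λ P Q → ⟪⟫-++ P Q monomial
              }
            ; ε-homo = refl
            }
          ; *-homo = evalAt-*
          }
        ; 1#-homo = refl
        }
      ; -‿homo = λ P → ⟪⟫-neg P monomial
      }

-- Determinants

module Determinant {c ℓ} (R : CommutativeRing c ℓ) where
  open CommutativeRing R hiding (zero)
  open import Algebra.Properties.Ring ring using (-‿distribʳ-*; -‿+-comm; -‿involutive; +-inverseˡ-unique)
  open FiniteSum +-commutativeMonoid using (sum; sum-cong; sum-zero; sum-remove; sum-updateAt; sum-reindex; ∑-distrib-+)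
  open import Function.Definitions using (Injective)
  open import Algebra.Properties.Semiring.Sum semiring using (*-distribʳ-sum)
  open import Data.Fin using (zero; suc; punchIn; punchOut; inject₁; _≟_)
  import Data.Fin.Properties as Fin
  open import Data.Fin.Induction using (<-weakInduction)
  open import Data.Vec.Functional using (updateAt)
  open import Data.Vec.Functional.Properties using (updateAt-updates; updateAt-minimal)
  import Relation.Binary.PropositionalEquality as ≡
  open import Relation.Binary.Reasoning.Setoid setoid
  open import Relation.Nullary using (yes; no; contradiction)

  Matrix : ℕ → Set c
  Matrix n = Fin n → Fin n → Carrier

  signed : ℕ → Carrier → Carrier
  signed zero    x = x
  signed (suc k) x = - signed k x

  minorAt : ∀ {n} → Matrix (suc n) → Fin (suc n) → Matrix n
  minorAt M j r c = M (suc r) (punchIn j c)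

  determinant : ∀ n → Matrix n → Carrier
  determinant zero    M = 1#
  determinant (suc n) M = sum (λ j → signed (toℕ j) (M zero j * determinant n (minorAt M j)))

  signed-cong : ∀ k {x y} → x ≈ y → signed k x ≈ signed k y
  signed-cong zero    e = e
  signed-cong (suc k) e = -‿cong (signed-cong k e)

  signed-+ : ∀ k x y → signed k (x + y) ≈ signed k x + signed k y
  signed-+ zero    x y = refl
  signed-+ (suc k) x y = trans (-‿cong (signed-+ k x y)) (sym (-‿+-comm (signed k x) (signed k y)))

  signed-*ˡ : ∀ k x y → signed k (x * y) ≈ x * signed k y
  signed-*ˡ zero    x y = refl
  signed-*ˡ (suc k) x y = trans (-‿cong (signed-*ˡ k x y)) (-‿distribʳ-* x (signed k y))

  signed-neg : ∀ k x → signed k (- x) ≈ - signed k x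
  signed-neg zero    x = refl
  signed-neg (suc k) x = -‿cong (signed-neg k x)

  determinant-cong : ∀ n {M N : Matrix n} → (∀ r c → M r c ≈ N r c) → determinant n M ≈ determinant n N
  determinant-cong zero    e = refl
  determinant-cong (suc n) e = sum-cong {suc n} (λ j → signed-cong (toℕ j)
    (*-cong (e zero j) (determinant-cong n (λ r c → e (suc r) (punchIn j c)))))

  determinant-additive : ∀ n (A B C : Matrix n) k →
    (∀ r → A r k ≈ B r k + C r k) →
    (∀ r c → c ≢ k → A r c ≈ B r c × A r c ≈ C r c) →
    determinant n A ≈ determinant n B + determinant n C
  determinant-additive (suc n) A B C k split same =
    trans (sum-cong {suc n} (λ j → trans (signed-cong (toℕ j) (expand j)) (signed-+ (toℕ j) _ _)))
          (∑-distrib-+ (λ j → signed (toℕ j) (B zero j * determinant n (minorAt B j)))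
                       (λ j → signed (toℕ j) (C zero j * determinant n (minorAt C j))))
    where
      expand : ∀ j → A zero j * determinant n (minorAt A j) ≈ B zero j * determinant n (minorAt B j) + C zero j * determinant n (minorAt C j)
      expand j with j ≟ k
      ... | yes ≡.refl = begin
          A zero j * determinant n (minorAt A j)
        ≈⟨ *-congʳ (split zero) ⟩
          (B zero j + C zero j) * determinant n (minorAt A j)
        ≈⟨ distribʳ _ _ _ ⟩
          B zero j * determinant n (minorAt A j) + C zero j * determinant n (minorAt A j)
        ≈⟨ +-cong (*-congˡ (determinant-cong n (λ r c → proj₁ (same (suc r) (punchIn j c) (Fin.punchInᵢ≢i j c)))))
                  (*-congˡ (determinant-cong n (λ r c → proj₂ (same (suc r) (punchIn j c) (Fin.punchInᵢ≢i j c))))) ⟩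
          B zero j * determinant n (minorAt B j) + C zero j * determinant n (minorAt C j) ∎
      ... | no j≢k = begin
          A zero j * determinant n (minorAt A j)
        ≈⟨ *-congˡ (determinant-additive n (minorAt A j) (minorAt B j) (minorAt C j) (punchOut j≢k) split′ same′) ⟩
          A zero j * (determinant n (minorAt B j) + determinant n (minorAt C j))
        ≈⟨ distribˡ _ _ _ ⟩
          A zero j * determinant n (minorAt B j) + A zero j * determinant n (minorAt C j)
        ≈⟨ +-cong (*-congʳ (proj₁ (same zero j j≢k))) (*-congʳ (proj₂ (same zero j j≢k))) ⟩
          B zero j * determinant n (minorAt B j) + C zero j * determinant n (minorAt C j) ∎
        where
          split′ : ∀ r → minorAt A j r (punchOut j≢k) ≈ minorAt B j r (punchOut j≢k) + minorAt C j r (punchOut j≢k)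
          split′ r rewrite Fin.punchIn-punchOut j≢k = split (suc r)
          same′ : ∀ r c → c ≢ punchOut j≢k → minorAt A j r c ≈ minorAt B j r c × minorAt A j r c ≈ minorAt C j r c
          same′ r c c≢ = same (suc r) (punchIn j c) (λ eq →
            c≢ (Fin.punchIn-injective j c _ (≡.trans eq (≡.sym (Fin.punchIn-punchOut j≢k)))))

  punchIn-inject₁-self : ∀ {m} (k : Fin m) → punchIn (inject₁ k) k ≡ suc k
  punchIn-inject₁-self zero    = ≡.refl
  punchIn-inject₁-self (suc k) = ≡.cong suc (punchIn-inject₁-self k)

  punchIn-inject₁≡punchIn-suc : ∀ {m} (k c : Fin m) → c ≢ k → punchIn (inject₁ k) c ≡ punchIn (suc k) c
  punchIn-inject₁≡punchIn-suc zero    zero    c≢k = contradiction ≡.refl c≢k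
  punchIn-inject₁≡punchIn-suc zero    (suc c) c≢k = ≡.refl
  punchIn-inject₁≡punchIn-suc (suc k) zero    c≢k = ≡.refl
  punchIn-inject₁≡punchIn-suc (suc k) (suc c) c≢k =
    ≡.cong suc (punchIn-inject₁≡punchIn-suc k c (λ c≡k → c≢k (≡.cong suc c≡k)))

  RowSumsZero : ∀ {n} → Matrix n → Set ℓ
  RowSumsZero M = ∀ r → sum (M r) ≈ 0#

  -- Adding column suc k to column k of the minor at suc k gives a matrix with zero row sums whose
  -- determinant is, by additivity in column k, the sum of the minors at suc k and inject₁ k.
  adjacent-minors-cancel :
    ∀ {m} → (∀ (X : Matrix (suc m)) → RowSumsZero X → determinant (suc m) X ≈ 0#) →
    ∀ (M : Matrix (suc (suc m))) → RowSumsZero M → ∀ k →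
    determinant (suc m) (minorAt M (suc k)) + determinant (suc m) (minorAt M (inject₁ k)) ≈ 0#
  adjacent-minors-cancel {m} vanish M rows k = begin
      determinant (suc m) (minorAt M (suc k)) + determinant (suc m) (minorAt M (inject₁ k))
    ≈⟨ determinant-additive (suc m) merged (minorAt M (suc k)) (minorAt M (inject₁ k)) k split same ⟨
      determinant (suc m) merged
    ≈⟨ vanish merged merged-rows ⟩
      0# ∎
    where
      merged : Matrix (suc m)
      merged r = updateAt (minorAt M (suc k) r) k (_+ M (suc r) (suc k))
      split : ∀ r → merged r k ≈ minorAt M (suc k) r k + minorAt M (inject₁ k) r k
      split r = reflexive (≡.trans (updateAt-updates k (minorAt M (suc k) r))
                                   (≡.cong (λ c → minorAt M (suc k) r k + M (suc r) c) (≡.sym (punchIn-inject₁-self k))))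
      same : ∀ r c → c ≢ k → merged r c ≈ minorAt M (suc k) r c × merged r c ≈ minorAt M (inject₁ k) r c
      same r c c≢k = reflexive off ,
                     reflexive (≡.trans off (≡.cong (M (suc r)) (≡.sym (punchIn-inject₁≡punchIn-suc k c c≢k))))
        where off = updateAt-minimal c k (minorAt M (suc k) r) c≢k
      merged-rows : RowSumsZero merged
      merged-rows r = begin
          sum (merged r)
        ≈⟨ sum-updateAt (minorAt M (suc k) r) k (M (suc r) (suc k)) ⟩
          M (suc r) (suc k) + sum (minorAt M (suc k) r)
        ≈⟨ sum-remove {i = suc k} (M (suc r)) ⟨
          sum (M (suc r))
        ≈⟨ rows (suc r) ⟩
          0# ∎

  determinant-rowSumsZero : ∀ n (M : Matrix (suc n)) → RowSumsZero M → determinant (suc n) M ≈ 0#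
  determinant-rowSumsZero zero    M rows = trans (+-congʳ (*-identityʳ (M zero zero))) (rows zero)
  determinant-rowSumsZero (suc m) M rows = begin
      sum (λ j → signed (toℕ j) (M zero j * D j))
    ≈⟨ sum-cong {suc (suc m)} (λ j → trans (signed-*ˡ (toℕ j) (M zero j) (D j)) (*-congˡ (alternating j))) ⟩
      sum (λ j → M zero j * D zero)
    ≈⟨ *-distribʳ-sum (D zero) (M zero) ⟨
      sum (M zero) * D zero
    ≈⟨ *-congʳ (rows zero) ⟩
      0# * D zero
    ≈⟨ zeroˡ (D zero) ⟩
      0# ∎
    where
      D : Fin (suc (suc m)) → Carrier
      D j = determinant (suc m) (minorAt M j)
      step : ∀ i → signed (toℕ (inject₁ i)) (D (inject₁ i)) ≈ D zero → signed (toℕ (suc i)) (D (suc i)) ≈ D zero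
      step i ih = begin
          - signed (toℕ i) (D (suc i))
        ≈⟨ -‿cong (signed-cong (toℕ i) (+-inverseˡ-unique _ _
             (adjacent-minors-cancel (determinant-rowSumsZero m) M rows i))) ⟩
          - signed (toℕ i) (- D (inject₁ i))
        ≈⟨ -‿cong (signed-neg (toℕ i) (D (inject₁ i))) ⟩
          - - signed (toℕ i) (D (inject₁ i))
        ≈⟨ -‿involutive _ ⟩
          signed (toℕ i) (D (inject₁ i))
        ≡⟨ ≡.cong (λ k → signed k (D (inject₁ i))) (≡.sym (Fin.toℕ-inject₁ i)) ⟩
          signed (toℕ (inject₁ i)) (D (inject₁ i))
        ≈⟨ ih ⟩
          D zero ∎
      alternating : ∀ j → signed (toℕ j) (D j) ≈ D zero
      alternating = <-weakInduction (λ j → signed (toℕ j) (D j) ≈ D zero) refl step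

  determinant-minor-rowSumsZero : ∀ n (M : Matrix (suc n)) → RowSumsZero M →
    ∀ (f g : Fin (suc n) → Fin (suc n)) → Injective _≡_ _≡_ g → determinant (suc n) (λ r c → M (f r) (g c)) ≈ 0#
  determinant-minor-rowSumsZero n M rows f g g-inj =
    determinant-rowSumsZero n (λ r c → M (f r) (g c)) (λ r → trans (sum-reindex g g-inj (M (f r))) (rows (f r)))

  determinant-firstRowDiagonal : ∀ n (M : Matrix (suc n)) → (∀ c → M zero (suc c) ≈ 0#) →
    determinant (suc n) M ≈ M zero zero * determinant n (λ r c → M (suc r) (suc c))
  determinant-firstRowDiagonal n M zeros =
    trans (+-congˡ (trans (sum-cong {n} vanishing) (sum-zero n))) (+-identityʳ _)
    where
      vanishing : ∀ j → signed (suc (toℕ j)) (M zero (suc j) * determinant n (minorAt M (suc j))) ≈ 0#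
      vanishing j = trans (signed-*ˡ (suc (toℕ j)) _ _) (trans (*-congʳ (zeros j)) (zeroˡ _))

module _ {c₁ ℓ₁ c₂ ℓ₂} {R : CommutativeRing c₁ ℓ₁} {S : CommutativeRing c₂ ℓ₂}
         {h : CommutativeRing.Carrier R → CommutativeRing.Carrier S}
         (h-homo : IsRingHomomorphism (CommutativeRing.rawRing R) (CommutativeRing.rawRing S) h) where
  private
    module R = CommutativeRing R
    module S = CommutativeRing S
    module DR = Determinant R
    module DS = Determinant S
    module ΣR = FiniteSum R.+-commutativeMonoid
    module ΣS = FiniteSum S.+-commutativeMonoid
  open IsRingHomomorphism h-homo using (+-homo; 0#-homo; *-homo; 1#-homo; -‿homo)

  sum-homo : ∀ n (f : Fin n → R.Carrier) → h (ΣR.sum f) S.≈ ΣS.sum (λ k → h (f k))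
  sum-homo zero    f = 0#-homo
  sum-homo (suc n) f = S.trans (+-homo _ _) (S.+-congˡ (sum-homo n (λ k → f (Fin.suc k))))

  signed-homo : ∀ k x → h (DR.signed k x) S.≈ DS.signed k (h x)
  signed-homo zero    x = S.refl
  signed-homo (suc k) x = S.trans (-‿homo _) (S.-‿cong (signed-homo k x))

  determinant-homo : ∀ n M → h (DR.determinant n M) S.≈ DS.determinant n (λ r c → h (M r c))
  determinant-homo zero    M = 1#-homo
  determinant-homo (suc n) M = S.trans (sum-homo (suc n) term) (ΣS.sum-cong {suc n} λ j →
    S.trans (signed-homo (toℕ j) (M Fin.zero j R.* minorDeterminant j))
            (DS.signed-cong (toℕ j) (S.trans (*-homo (M Fin.zero j) (minorDeterminant j))
                                             (S.*-congˡ (determinant-homo n (DR.minorAt M j))))))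
    where
      minorDeterminant term : Fin (suc n) → R.Carrier
      minorDeterminant j = DR.determinant n (DR.minorAt M j)
      term j = DR.signed (toℕ j) (M Fin.zero j R.* minorDeterminant j)

module _ where
  open Determinant ℤ.+-*-commutativeRing using (Matrix; determinant; determinant-firstRowDiagonal)
  open import Data.Integer using (0ℤ)
  open import Data.Sum using (inj₁; inj₂)
  open import Data.Nat using (z≤n; s≤s)
  open import Relation.Binary.PropositionalEquality using (sym; trans)

  lowerTriangular-determinant≢0 : ∀ n (M : Matrix n) →
    (∀ r c → r Fin.< c → M r c ≡ 0ℤ) → (∀ r → M r r ≢ 0ℤ) → determinant n M ≢ 0ℤ
  lowerTriangular-determinant≢0 zero    M upper≡0 diagonal≢0 ()
  lowerTriangular-determinant≢0 (suc n) M upper≡0 diagonal≢0 det≡0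
    with ℤ.i*j≡0⇒i≡0∨j≡0 (M Fin.zero Fin.zero)
           (trans (sym (determinant-firstRowDiagonal n M (λ c → upper≡0 Fin.zero (Fin.suc c) (s≤s z≤n)))) det≡0)
  ... | inj₁ corner≡0 = diagonal≢0 Fin.zero corner≡0
  ... | inj₂ rest≡0   = lowerTriangular-determinant≢0 n (λ r c → M (Fin.suc r) (Fin.suc c))
                          (λ r c r<c → upper≡0 (Fin.suc r) (Fin.suc c) (s≤s r<c)) (λ r → diagonal≢0 (Fin.suc r)) rest≡0

module _ where
  open PolynomialRing using (+P-*P-commutativeRing)
  open Determinant +P-*P-commutativeRing using (signed; determinant)
  open FiniteSum (CommutativeRing.+-commutativeMonoid +P-*P-commutativeRing) using (sum)
  open import Relation.Binary.PropositionalEquality using (refl; trans; cong; cong₂)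

  sumFin≡sum : ∀ n {f g : Fin n → Poly} → (∀ k → f k ≡ g k) → sumFin n f ≡ sum g
  sumFin≡sum zero    e = refl
  sumFin≡sum (suc n) e = cong₂ _+P_ (e Fin.zero) (sumFin≡sum n (λ k → e (Fin.suc k)))

  altSign≡signed : ∀ k P → altSign k P ≡ signed k P
  altSign≡signed zero    P = refl
  altSign≡signed (suc k) P = cong -P_ (altSign≡signed k P)

  det≡determinant : ∀ n M → det n M ≡ determinant n M
  det≡determinant zero    M = refl
  det≡determinant (suc n) M = sumFin≡sum (suc n) (λ j →
    trans (altSign≡signed (toℕ j) _)
          (cong (λ D → signed (toℕ j) (M Fin.zero j *P D)) (det≡determinant n (λ r c → M (Fin.suc r) (Fin.punchIn j c)))))

_<lex_ : ℕ × ℕ → ℕ × ℕ → Set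
_<lex_ = ×-Lex _≡_ ℕ._<_ ℕ._<_

module _ {m n : ℕ} where
  open import Data.Fin using (combine; remQuot)
  open import Data.Fin.Properties using (<-cmp; toℕ-combine; combine-monoˡ-<; combine-remQuot)
  open import Data.Product using (map)
  open import Data.Sum using (inj₁; inj₂)
  import Data.Nat.Properties as ℕ
  open import Relation.Binary.Definitions using (tri<; tri≈; tri>)
  open import Relation.Binary.PropositionalEquality using (refl; sym; trans; cong; subst₂)
  open import Relation.Nullary using (contradiction)

  combine-<lex : ∀ (a c : Fin m) (b d : Fin n) → combine a b Fin.< combine c d →
    (toℕ a , toℕ b) <lex (toℕ c , toℕ d)
  combine-<lex a c b d lt with <-cmp a c
  ... | tri< a<c _ _ = inj₁ a<c
  ... | tri≈ _ refl _ = inj₂ (refl , ℕ.+-cancelˡ-< (n ℕ.* toℕ a) (toℕ b) (toℕ d)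
                                      (subst₂ ℕ._<_ (toℕ-combine a b) (toℕ-combine a d) lt))
  ... | tri> _ _ c<a = contradiction lt (ℕ.<-asym (combine-monoˡ-< d b c<a))

  remQuot-<lex : ∀ (x y : Fin (m ℕ.* n)) → x Fin.< y →
    map toℕ toℕ (remQuot {m} n x) <lex map toℕ toℕ (remQuot {m} n y)
  remQuot-<lex x y x<y =
    combine-<lex _ _ _ _ (subst₂ Fin._<_ (sym (combine-remQuot {m} n x)) (sym (combine-remQuot {m} n y)) x<y)

  toℕ-remQuot : ∀ (x : Fin (m ℕ.* n)) → toℕ x ≡ n ℕ.* toℕ (proj₁ (remQuot {m} n x)) ℕ.+ toℕ (proj₂ (remQuot {m} n x))
  toℕ-remQuot x = trans (cong toℕ (sym (combine-remQuot {m} n x))) (toℕ-combine (proj₁ (remQuot {m} n x)) (proj₂ (remQuot {m} n x)))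

-- The matrix B

module DASEP (p : ℕ) where
  open import Data.Integer using (+_)
  open import Relation.Binary.PropositionalEquality using (refl)

  s : ℕ → ℕ → Poly
  s x y = if x <ᵇ y then constP (+ 2) +P tP else if y <ᵇ x then 1P +P constP (+ 2) *P tP else 0P

  r : ℕ → ℕ → Poly
  r x y = s x y +P uP *P ([ suc x <ᵇ p ] +P [ suc y <ᵇ p ]) +P [ 0 <ᵇ x ] +P [ 0 <ᵇ y ]

  stay swapped fromNext₁ fromNext₂ fromPrev₁ fromPrev₂ entry : ℕ → ℕ → ℕ → ℕ → Poly
  stay      α β x y = [ (α ≡ᵇ x) ∧ (β ≡ᵇ y) ] *P r x y
  swapped   α β x y = [ (α ≡ᵇ y) ∧ (β ≡ᵇ x) ] *P s y x
  fromNext₁ α β x y = [ suc x <ᵇ p ] *P [ (α ≡ᵇ suc x) ∧ (β ≡ᵇ y) ]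
  fromNext₂ α β x y = [ suc y <ᵇ p ] *P [ (α ≡ᵇ x) ∧ (β ≡ᵇ suc y) ]
  fromPrev₁ α β x y = uP *P [ 0 <ᵇ x ] *P [ (suc α ≡ᵇ x) ∧ (β ≡ᵇ y) ]
  fromPrev₂ α β x y = uP *P [ 0 <ᵇ y ] *P [ (α ≡ᵇ x) ∧ (suc β ≡ᵇ y) ]
  entry     α β x y = stay α β x y -P swapped α β x y -P fromNext₁ α β x y -P fromNext₂ α β x y
                        -P fromPrev₁ α β x y -P fromPrev₂ α β x y

  coefA≡entry : ∀ a b i j → coefA p a b i j ≡ entry (toℕ a) (toℕ b) (toℕ i) (toℕ j)
  coefA≡entry a b i j = refl


module RowSums (p : ℕ) where
  open DASEP p
  open PolynomialRing using (_≈P_; +P-*P-commutativeRing; isZero?; [_]*-if; [true]*)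
  private
    module ℙ = CommutativeRing +P-*P-commutativeRing
  open FiniteSum ℙ.+-commutativeMonoid using (sum; sum-cong; sum-zero; sum-indicator; sum-remQuot; ∑-distrib-+)
  open import Algebra.Properties.Semiring.Sum ℙ.semiring using (*-distribˡ-sum)
  open import Data.Fin using (remQuot)
  import Data.Fin.Properties as Fin
  open import Data.Nat using (_<_)
  import Data.Nat.Properties as ℕ
  open import Data.Bool.Properties using (∧-comm; ∧-zeroʳ)
  open import Data.Maybe as Maybe using (Maybe)
  open import Relation.Nullary.Decidable using (dec⇒maybe)
  open import Relation.Binary.PropositionalEquality using (cong)
  open import Relation.Binary.Reasoning.Setoid ℙ.setoid

  row-identity : ∀ σ υ a b c d → (σ +P υ *P (a +P b) +P c +P d) -P σ -P c -P d -P υ *P a -P υ *P b ≈P 0P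
  row-identity = solve 6 (λ σ υ a b c d →
    (σ ⊕ υ ⊗ (a ⊕ b) ⊕ c ⊕ d) ⊕ ⊝ σ ⊕ ⊝ c ⊕ ⊝ d ⊕ ⊝ (υ ⊗ a) ⊕ ⊝ (υ ⊗ b) ⊜ Κ 0P) ℙ.refl
    where
      zero? : ∀ P → Maybe (0P ≈P P)
      zero? P = Maybe.map (λ z → ℙ.sym (PolynomialRing.mk≈ z)) (dec⇒maybe (isZero? P))
      open import Tactic.RingSolver.Core.AlmostCommutativeRing using (fromCommutativeRing)
      open import Tactic.RingSolver.NonReflective (fromCommutativeRing +P-*P-commutativeRing zero?)

  Σ² : (Fin p → Fin p → Poly) → Poly
  Σ² F = sum (λ i → sum (λ j → F i j))

  Σ²-cong : ∀ {F G} → (∀ i j → F i j ≈P G i j) → Σ² F ≈P Σ² G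
  Σ²-cong e = sum-cong {p} (λ i → sum-cong {p} (e i))

  Σ²-zero : ∀ {F} → (∀ i j → F i j ≈P 0P) → Σ² F ≈P 0P
  Σ²-zero e = ℙ.trans (Σ²-cong e) (ℙ.trans (sum-cong {p} (λ _ → sum-zero p)) (sum-zero p))

  Σ²-−-cong : ∀ {F G X Y} → Σ² F ≈P X → Σ² G ≈P Y → Σ² (λ i j → F i j -P G i j) ≈P X -P Y
  Σ²-−-cong {F} {G} {X} {Y} eF eG = begin
      Σ² (λ i j → F i j -P G i j)
    ≈⟨ sum-cong {p} (λ i → ℙ.trans (∑-distrib-+ (F i) (λ j → -P G i j)) (ℙ.+-congˡ (sum-neg +P-*P-commutativeRing (G i)))) ⟩
      sum (λ i → sum (F i) -P sum (G i))
    ≈⟨ ℙ.trans (∑-distrib-+ (λ i → sum (F i)) (λ i → -P sum (G i))) (ℙ.+-congˡ (sum-neg +P-*P-commutativeRing (λ i → sum (G i)))) ⟩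
      Σ² F -P Σ² G
    ≈⟨ ℙ.+-cong eF (ℙ.-‿cong eG) ⟩
      X -P Y ∎

  sum-[≡ᵇ]* : ∀ c (f : ℕ → Poly) → sum {p} (λ k → [ c ≡ᵇ toℕ k ] *P f (toℕ k)) ≈P [ c <ᵇ p ] *P f c
  sum-[≡ᵇ]* c f = begin
      sum {p} (λ k → [ c ≡ᵇ toℕ k ] *P f (toℕ k))
    ≈⟨ sum-cong {p} (λ k → [ c ≡ᵇ toℕ k ]*-if (f (toℕ k))) ⟩
      sum {p} (λ k → if c ≡ᵇ toℕ k then f (toℕ k) else 0P)
    ≈⟨ sum-indicator p c f ⟩
      (if c <ᵇ p then f c else 0P)
    ≈⟨ [ c <ᵇ p ]*-if (f c) ⟨
      [ c <ᵇ p ] *P f c ∎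

  Σ²-indicator : ∀ c d (F : ℕ → ℕ → Poly) →
    Σ² (λ i j → [ (c ≡ᵇ toℕ i) ∧ (d ≡ᵇ toℕ j) ] *P F (toℕ i) (toℕ j)) ≈P [ c <ᵇ p ] *P ([ d <ᵇ p ] *P F c d)
  Σ²-indicator c d F = begin
      Σ² (λ i j → [ (c ≡ᵇ toℕ i) ∧ (d ≡ᵇ toℕ j) ] *P F (toℕ i) (toℕ j))
    ≈⟨ Σ²-cong (λ i j → ℙ.trans (ℙ.*-congʳ ([∧] (c ≡ᵇ toℕ i) (d ≡ᵇ toℕ j))) (ℙ.*-assoc [ c ≡ᵇ toℕ i ] [ d ≡ᵇ toℕ j ] (F (toℕ i) (toℕ j)))) ⟩
      sum {p} (λ i → sum {p} (λ j → [ c ≡ᵇ toℕ i ] *P ([ d ≡ᵇ toℕ j ] *P F (toℕ i) (toℕ j))))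
    ≈⟨ sum-cong {p} (λ i → ℙ.trans (ℙ.sym (*-distribˡ-sum {p} [ c ≡ᵇ toℕ i ] (λ j → [ d ≡ᵇ toℕ j ] *P F (toℕ i) (toℕ j)))) (ℙ.*-congˡ {[ c ≡ᵇ toℕ i ]} (sum-[≡ᵇ]* d (F (toℕ i))))) ⟩
      sum {p} (λ i → [ c ≡ᵇ toℕ i ] *P ([ d <ᵇ p ] *P F (toℕ i) d))
    ≈⟨ sum-[≡ᵇ]* c (λ x → [ d <ᵇ p ] *P F x d) ⟩
      [ c <ᵇ p ] *P ([ d <ᵇ p ] *P F c d) ∎
    where
      [∧] : ∀ x y → [ x ∧ y ] ≈P [ x ] *P [ y ]
      [∧] true  y = ℙ.sym (ℙ.*-identityˡ [ y ])
      [∧] false y = ℙ.refl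

  [true]²* : ∀ {c d} X → c < p → d < p → [ c <ᵇ p ] *P ([ d <ᵇ p ] *P X) ≈P X
  [true]²* X c<p d<p = ℙ.trans ([true]* _ (<ᵇ-true c<p)) ([true]* X (<ᵇ-true d<p))

  module _ {α β} (α<p : α < p) (β<p : β < p) where
    Σ²-stay : Σ² (λ i j → stay α β (toℕ i) (toℕ j)) ≈P r α β
    Σ²-stay = ℙ.trans (Σ²-indicator α β r) ([true]²* (r α β) α<p β<p)

    Σ²-swapped : Σ² (λ i j → swapped α β (toℕ i) (toℕ j)) ≈P s α β
    Σ²-swapped = begin
        Σ² (λ i j → swapped α β (toℕ i) (toℕ j))
      ≈⟨ Σ²-cong (λ i j → ℙ.reflexive (cong (λ b → [ b ] *P s (toℕ j) (toℕ i)) (∧-comm (α ≡ᵇ toℕ j) (β ≡ᵇ toℕ i)))) ⟩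
        Σ² (λ i j → [ (β ≡ᵇ toℕ i) ∧ (α ≡ᵇ toℕ j) ] *P s (toℕ j) (toℕ i))
      ≈⟨ Σ²-indicator β α (λ x y → s y x) ⟩
        [ β <ᵇ p ] *P ([ α <ᵇ p ] *P s α β)
      ≈⟨ [true]²* (s α β) β<p α<p ⟩
        s α β ∎

    Σ²-fromPrev₁ : Σ² (λ i j → fromPrev₁ α β (toℕ i) (toℕ j)) ≈P uP *P [ suc α <ᵇ p ]
    Σ²-fromPrev₁ = begin
        Σ² (λ i j → fromPrev₁ α β (toℕ i) (toℕ j))
      ≈⟨ Σ²-cong (λ i j → ℙ.*-comm (uP *P [ 0 <ᵇ toℕ i ]) [ (suc α ≡ᵇ toℕ i) ∧ (β ≡ᵇ toℕ j) ]) ⟩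
        Σ² (λ i j → [ (suc α ≡ᵇ toℕ i) ∧ (β ≡ᵇ toℕ j) ] *P (uP *P [ 0 <ᵇ toℕ i ]))
      ≈⟨ Σ²-indicator (suc α) β (λ x _ → uP *P [ 0 <ᵇ x ]) ⟩
        [ suc α <ᵇ p ] *P ([ β <ᵇ p ] *P (uP *P 1P))
      ≈⟨ ℙ.*-congˡ {[ suc α <ᵇ p ]} (ℙ.trans ([true]* (uP *P 1P) (<ᵇ-true β<p)) (ℙ.*-identityʳ uP)) ⟩
        [ suc α <ᵇ p ] *P uP
      ≈⟨ ℙ.*-comm [ suc α <ᵇ p ] uP ⟩
        uP *P [ suc α <ᵇ p ] ∎

    Σ²-fromPrev₂ : Σ² (λ i j → fromPrev₂ α β (toℕ i) (toℕ j)) ≈P uP *P [ suc β <ᵇ p ]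
    Σ²-fromPrev₂ = begin
        Σ² (λ i j → fromPrev₂ α β (toℕ i) (toℕ j))
      ≈⟨ Σ²-cong (λ i j → ℙ.*-comm (uP *P [ 0 <ᵇ toℕ j ]) [ (α ≡ᵇ toℕ i) ∧ (suc β ≡ᵇ toℕ j) ]) ⟩
        Σ² (λ i j → [ (α ≡ᵇ toℕ i) ∧ (suc β ≡ᵇ toℕ j) ] *P (uP *P [ 0 <ᵇ toℕ j ]))
      ≈⟨ Σ²-indicator α (suc β) (λ _ y → uP *P [ 0 <ᵇ y ]) ⟩
        [ α <ᵇ p ] *P ([ suc β <ᵇ p ] *P (uP *P 1P))
      ≈⟨ ℙ.trans ([true]* ([ suc β <ᵇ p ] *P (uP *P 1P)) (<ᵇ-true α<p)) (ℙ.*-congˡ {[ suc β <ᵇ p ]} (ℙ.*-identityʳ uP)) ⟩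
        [ suc β <ᵇ p ] *P uP
      ≈⟨ ℙ.*-comm [ suc β <ᵇ p ] uP ⟩
        uP *P [ suc β <ᵇ p ] ∎

  Σ²-fromNext₁ : ∀ {α β} → α < p → β < p → Σ² (λ i j → fromNext₁ α β (toℕ i) (toℕ j)) ≈P [ 0 <ᵇ α ]
  Σ²-fromNext₁ {zero}  _   _   = Σ²-zero (λ i j → ℙ.zeroʳ [ suc (toℕ i) <ᵇ p ])
  Σ²-fromNext₁ {suc a} {β} α<p β<p = begin
      Σ² (λ i j → fromNext₁ (suc a) β (toℕ i) (toℕ j))
    ≈⟨ Σ²-cong (λ i j → ℙ.*-comm [ suc (toℕ i) <ᵇ p ] [ (a ≡ᵇ toℕ i) ∧ (β ≡ᵇ toℕ j) ]) ⟩
      Σ² (λ i j → [ (a ≡ᵇ toℕ i) ∧ (β ≡ᵇ toℕ j) ] *P [ suc (toℕ i) <ᵇ p ])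
    ≈⟨ Σ²-indicator a β (λ x _ → [ suc x <ᵇ p ]) ⟩
      [ a <ᵇ p ] *P ([ β <ᵇ p ] *P [ suc a <ᵇ p ])
    ≈⟨ [true]²* _ (ℕ.<-trans (ℕ.n<1+n a) α<p) β<p ⟩
      [ suc a <ᵇ p ]
    ≡⟨ cong [_] (<ᵇ-true α<p) ⟩
      1P ∎

  Σ²-fromNext₂ : ∀ {α β} → α < p → β < p → Σ² (λ i j → fromNext₂ α β (toℕ i) (toℕ j)) ≈P [ 0 <ᵇ β ]
  Σ²-fromNext₂ {α} {zero}  _   _   = Σ²-zero (λ i j →
    ℙ.trans (ℙ.*-congˡ {[ suc (toℕ j) <ᵇ p ]} (ℙ.reflexive (cong [_] (∧-zeroʳ (α ≡ᵇ toℕ i))))) (ℙ.zeroʳ [ suc (toℕ j) <ᵇ p ]))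
  Σ²-fromNext₂ {α} {suc b} α<p β<p = begin
      Σ² (λ i j → fromNext₂ α (suc b) (toℕ i) (toℕ j))
    ≈⟨ Σ²-cong (λ i j → ℙ.*-comm [ suc (toℕ j) <ᵇ p ] [ (α ≡ᵇ toℕ i) ∧ (b ≡ᵇ toℕ j) ]) ⟩
      Σ² (λ i j → [ (α ≡ᵇ toℕ i) ∧ (b ≡ᵇ toℕ j) ] *P [ suc (toℕ j) <ᵇ p ])
    ≈⟨ Σ²-indicator α b (λ _ y → [ suc y <ᵇ p ]) ⟩
      [ α <ᵇ p ] *P ([ b <ᵇ p ] *P [ suc b <ᵇ p ])
    ≈⟨ [true]²* _ α<p (ℕ.<-trans (ℕ.n<1+n b) β<p) ⟩
      [ suc b <ᵇ p ]
    ≡⟨ cong [_] (<ᵇ-true β<p) ⟩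
      1P ∎

  Σ²-entry : ∀ {α β} → α < p → β < p → Σ² (λ i j → entry α β (toℕ i) (toℕ j)) ≈P 0P
  Σ²-entry {α} {β} α<p β<p = ℙ.trans
    (Σ²-−-cong (Σ²-−-cong (Σ²-−-cong (Σ²-−-cong (Σ²-−-cong (Σ²-stay α<p β<p) (Σ²-swapped α<p β<p))
      (Σ²-fromNext₁ α<p β<p)) (Σ²-fromNext₂ α<p β<p)) (Σ²-fromPrev₁ α<p β<p)) (Σ²-fromPrev₂ α<p β<p))
    (row-identity (s α β) uP [ suc α <ᵇ p ] [ suc β <ᵇ p ] [ 0 <ᵇ α ] [ 0 <ᵇ β ])

  B-rowSums : ∀ x → sum (B p x) ≈P 0P
  B-rowSums x = begin
      sum (B p x)
    ≈⟨ sum-remQuot p p (coefA p a b) ⟩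
      Σ² (coefA p a b)
    ≈⟨ Σ²-cong (λ i j → ℙ.reflexive (coefA≡entry a b i j)) ⟩
      Σ² (λ i j → entry (toℕ a) (toℕ b) (toℕ i) (toℕ j))
    ≈⟨ Σ²-entry (Fin.toℕ<n a) (Fin.toℕ<n b) ⟩
      0P ∎
    where
      a = proj₁ (remQuot {p} p x)
      b = proj₂ (remQuot {p} p x)

module Evaluation (p : ℕ) where
  open DASEP p
  open PolynomialRing using (mk≈; ⟪⟫-cong; evalAt; evalAt-isRingHomomorphism; [true]*)
  open import Data.Integer using (ℤ; -[1+_]; 0ℤ; _+_; _*_; -_)
  open import Data.Nat using (_<_)
  import Data.Nat.Properties as ℕ
  open import Data.Sum using (inj₁; inj₂)
  open import Relation.Nullary using (¬_; contradiction)
  open import Relation.Binary.PropositionalEquality using (refl; sym; trans; cong; cong₂; module ≡-Reasoning)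
  open import Data.Fin using (remQuot)

  -- t = -2 kills s_{x,y} = 2 + t for x < y, and u = 0 kills the u-terms.
  ev : Poly → ℤ
  ev = evalAt -[1+ 1 ] 0ℤ

  open IsRingHomomorphism (evalAt-isRingHomomorphism -[1+ 1 ] 0ℤ) using (⟦⟧-cong; +-homo; *-homo; -‿homo)

  ev-[true]* : ∀ {b} X → b ≡ true → ev ([ b ] *P X) ≡ ev X
  ev-[true]* X eq = ⟪⟫-cong ([true]* X eq) _

  ev-[false]* : ∀ {b} X → b ≡ false → ev ([ b ] *P X) ≡ 0ℤ
  ev-[false]* X refl = refl

  ev-*[false] : ∀ {b} X → b ≡ false → ev (X *P [ b ]) ≡ 0ℤ
  ev-*[false] X refl = trans (*-homo X 0P) (ℤ.*-zeroʳ (ev X))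

  ev-u* : ∀ X → ev (uP *P X) ≡ 0ℤ
  ev-u* X = *-homo uP X

  ev-u*-* : ∀ X Y → ev (uP *P X *P Y) ≡ 0ℤ
  ev-u*-* X Y = trans (*-homo (uP *P X) Y) (cong (_* ev Y) (ev-u* X))

  ev-−-vanishing : ∀ X Y → ev Y ≡ 0ℤ → ev (X -P Y) ≡ ev X
  ev-−-vanishing X Y e =
    trans (+-homo X (-P Y)) (trans (cong (λ z → ev X + z) (trans (-‿homo Y) (cong -_ e))) (ℤ.+-identityʳ (ev X)))

  ev-entry : ∀ α β x y → ev (swapped α β x y) ≡ 0ℤ → ev (fromNext₁ α β x y) ≡ 0ℤ → ev (fromNext₂ α β x y) ≡ 0ℤ →
    ev (entry α β x y) ≡ ev (stay α β x y)
  ev-entry α β x y swapped≡0 next₁≡0 next₂≡0 =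
    trans (ev-−-vanishing (X₂ -P fromNext₁ α β x y -P fromNext₂ α β x y -P fromPrev₁ α β x y) _ (ev-u*-* [ 0 <ᵇ y ] [ (α ≡ᵇ x) ∧ (suc β ≡ᵇ y) ]))
   (trans (ev-−-vanishing (X₂ -P fromNext₁ α β x y -P fromNext₂ α β x y) _ (ev-u*-* [ 0 <ᵇ x ] [ (suc α ≡ᵇ x) ∧ (β ≡ᵇ y) ]))
   (trans (ev-−-vanishing (X₂ -P fromNext₁ α β x y) _ next₂≡0)
   (trans (ev-−-vanishing X₂ _ next₁≡0)
          (ev-−-vanishing (stay α β x y) _ swapped≡0))))
    where X₂ = stay α β x y -P swapped α β x y

  module _ {α β x y : ℕ} where
    <lex⇒≢stay : (α , β) <lex (x , y) → ¬ (α ≡ x × β ≡ y)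
    <lex⇒≢stay (inj₁ α<x)       (refl , _)    = ℕ.<-irrefl refl α<x
    <lex⇒≢stay (inj₂ (_ , β<y)) (_    , refl) = ℕ.<-irrefl refl β<y

    <lex⇒≢next₁ : (α , β) <lex (x , y) → ¬ (α ≡ suc x × β ≡ y)
    <lex⇒≢next₁ (inj₁ 1+x<x)       (refl , _) = ℕ.<-asym 1+x<x (ℕ.n<1+n x)
    <lex⇒≢next₁ (inj₂ (1+x≡x , _)) (refl , _) = ℕ.1+n≢n 1+x≡x

    <lex⇒≢next₂ : (α , β) <lex (x , y) → ¬ (α ≡ x × β ≡ suc y)
    <lex⇒≢next₂ (inj₁ α<x)         (refl , _)    = ℕ.<-irrefl refl α<x
    <lex⇒≢next₂ (inj₂ (_ , 1+y<y)) (_    , refl) = ℕ.<-asym 1+y<y (ℕ.n<1+n y)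

  ev-swapped-upper : ∀ α β x y → (α , β) <lex (x , y) → ev (swapped α β x y) ≡ 0ℤ
  ev-swapped-upper α β x y lex with (α ≡ᵇ y) ∧ (β ≡ᵇ x) in eq
  ... | false = refl
  ... | true with ≡ᵇ-∧-true {α} {β} {y} {x} eq | lex
  ...   | refl , refl | inj₁ α<β rewrite <ᵇ-true α<β = refl
  ...   | refl , refl | inj₂ (refl , α<α) = contradiction α<α (ℕ.<-irrefl refl)

  ev-entry-upper : ∀ α β x y → (α , β) <lex (x , y) → ev (entry α β x y) ≡ 0ℤ
  ev-entry-upper α β x y lex = trans
    (ev-entry α β x y (ev-swapped-upper α β x y lex)
                      (ev-*[false] [ suc x <ᵇ p ] (≡ᵇ-∧-false (<lex⇒≢next₁ lex)))
                      (ev-*[false] [ suc y <ᵇ p ] (≡ᵇ-∧-false (<lex⇒≢next₂ lex))))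
    (ev-[false]* (r x y) (≡ᵇ-∧-false (<lex⇒≢stay lex)))

  ev-r : ∀ α β → ev (r α β) ≡ ev (s α β) + 0ℤ + ev [ 0 <ᵇ α ] + ev [ 0 <ᵇ β ]
  ev-r α β =
    trans (+-homo (s α β +P uP *P L +P [ 0 <ᵇ α ]) [ 0 <ᵇ β ]) (cong (_+ ev [ 0 <ᵇ β ])
   (trans (+-homo (s α β +P uP *P L) [ 0 <ᵇ α ]) (cong (_+ ev [ 0 <ᵇ α ])
   (trans (+-homo (s α β) (uP *P L)) (cong (λ z → ev (s α β) + z) (ev-u* L))))))
    where L = [ suc α <ᵇ p ] +P [ suc β <ᵇ p ]

  -- ev (r x y) is [x > 0] + [y > 0], minus 3 when x > y.
  ev-r≢0 : ∀ α β → ¬ (α ≡ 0 × β ≡ 0) → ev (r α β) ≢ 0ℤ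
  ev-r≢0 zero    zero    origin = contradiction (refl , refl) origin
  ev-r≢0 zero    (suc b) _ rewrite ev-r zero (suc b) = λ ()
  ev-r≢0 (suc a) zero    _ rewrite ev-r (suc a) zero = λ ()
  ev-r≢0 (suc a) (suc b) _ rewrite ev-r (suc a) (suc b) with a <ᵇ b | b <ᵇ a
  ... | true  | _     = λ ()
  ... | false | true  = λ ()
  ... | false | false = λ ()

  ev-swapped-diagonal : ∀ α β → ev (swapped α β α β) ≡ 0ℤ
  ev-swapped-diagonal α β with (α ≡ᵇ β) ∧ (β ≡ᵇ α) in eq
  ... | false = refl
  ... | true with ≡ᵇ-∧-true {α} {β} {β} {α} eq
  ...   | refl , _ rewrite <ᵇ-false (ℕ.<-irrefl (refl {x = α})) = refl

  ev-entry-diagonal : ∀ α β → ¬ (α ≡ 0 × β ≡ 0) → ev (entry α β α β) ≢ 0ℤ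
  ev-entry-diagonal α β not-origin entry≡0 = ev-r≢0 α β not-origin (begin
      ev (r α β)            ≡⟨ ev-[true]* (r α β) (≡ᵇ-∧-refl α β) ⟨
      ev (stay α β α β)     ≡⟨ ev-entry α β α β (ev-swapped-diagonal α β)
                                 (ev-*[false] [ suc α <ᵇ p ] (≡ᵇ-∧-false {α} {β} {suc α} {β} (λ (α≡1+α , _) → ℕ.1+n≢n (sym α≡1+α))))
                                 (ev-*[false] [ suc β <ᵇ p ] (≡ᵇ-∧-false {α} {β} {α} {suc β} (λ (_ , β≡1+β) → ℕ.1+n≢n (sym β≡1+β)))) ⟨
      ev (entry α β α β)    ≡⟨ entry≡0 ⟩
      0ℤ                    ∎)
    where open ≡-Reasoning

  ev-IsZero : ∀ P → IsZero P → ev P ≡ 0ℤ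
  ev-IsZero P z = ⟦⟧-cong {P} {0P} (mk≈ z)

  ev-det : ∀ n M → ev (det n M) ≡ Determinant.determinant ℤ.+-*-commutativeRing n (λ r c → ev (M r c))
  ev-det n M = trans (cong ev (det≡determinant n M)) (determinant-homo (evalAt-isRingHomomorphism -[1+ 1 ] 0ℤ) n M)

  B-upper : ∀ (x y : Fin (p ℕ.* p)) → x Fin.< y → ev (B p x y) ≡ 0ℤ
  B-upper x y x<y = trans (cong ev (coefA≡entry a b c d)) (ev-entry-upper _ _ _ _ (remQuot-<lex {p} {p} x y x<y))
    where
      a = proj₁ (remQuot {p} p x)
      b = proj₂ (remQuot {p} p x)
      c = proj₁ (remQuot {p} p y)
      d = proj₂ (remQuot {p} p y)

  B-diagonal : ∀ (x : Fin (p ℕ.* p)) → toℕ x ≢ 0 → ev (B p x x) ≢ 0ℤ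
  B-diagonal x x≢0 B≡0 = ev-entry-diagonal (toℕ a) (toℕ b) origin (trans (sym (cong ev (coefA≡entry a b a b))) B≡0)
    where
      open ≡-Reasoning
      a = proj₁ (remQuot {p} p x)
      b = proj₂ (remQuot {p} p x)
      origin : ¬ (toℕ a ≡ 0 × toℕ b ≡ 0)
      origin (a≡0 , b≡0) = x≢0 (begin
        toℕ x                    ≡⟨ toℕ-remQuot {p} {p} x ⟩
        p ℕ.* toℕ a ℕ.+ toℕ b    ≡⟨ cong₂ (λ i j → p ℕ.* i ℕ.+ j) a≡0 b≡0 ⟩
        p ℕ.* 0 ℕ.+ 0            ≡⟨ trans (ℕ.+-identityʳ (p ℕ.* 0)) (ℕ.*-zeroʳ p) ⟩
        0                        ∎)

open PolynomialRing using (coeff-≡; ≈-trans; ≡⇒≈; +P-*P-commutativeRing)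
open Determinant +P-*P-commutativeRing using (determinant-minor-rowSumsZero)
open import Data.Nat using (_≤_; _*_; _∸_; s≤s)
open import Data.Fin.Properties using (suc-injective)
open import Relation.Nullary using (¬_)
open import Relation.Binary.PropositionalEquality using (sym; trans)

mainTheorem2 : (p : ℕ) → 1 ≤ p → HasRank (B p) (p * p ∸ 1)
mainTheorem2 p@(suc _) (s≤s _) =
  (Fin.suc , Fin.suc , suc-injective , suc-injective , corner-minor≢0) ,
  λ f g _ g-inj → coeff-≡ (≈-trans (≡⇒≈ (det≡determinant (p * p) (minor (B p) f g)))
                                   (determinant-minor-rowSumsZero (p * p ∸ 1) (B p) B-rowSums f g g-inj))
  where
    open RowSums p using (B-rowSums)
    open Evaluation p using (ev; ev-IsZero; ev-det; B-upper; B-diagonal)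
    corner : Fin (p * p ∸ 1) → Fin (p * p ∸ 1) → Poly
    corner = minor (B p) Fin.suc Fin.suc
    corner-minor≢0 : ¬ IsZero (det (p * p ∸ 1) corner)
    corner-minor≢0 z = lowerTriangular-determinant≢0 (p * p ∸ 1) (λ r c → ev (corner r c))
      (λ r c r<c → B-upper (Fin.suc r) (Fin.suc c) (s≤s r<c))
      (λ r → B-diagonal (Fin.suc r) (λ ()))
      (trans (sym (ev-det (p * p ∸ 1) corner)) (ev-IsZero (det (p * p ∸ 1) corner) z))
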